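{- Let $(S,+)$ be a commutative semigroup and let $M\subseteq S\times S$ be piecewise syndetic in $S\times S$. Then for any $c\in S$ and any $a\in\mathbb{N}$, the set \[ \{(s+at+c,\,t):(s,t)\in M\} \] is piecewise syndetic in $S\times S$.
   Context: $\mathbb{N}=\{1,2,3,\ldots\}$. For $n\in\mathbb{N}$ and $t\in S$, $nt$ denotes $t+t+\cdots+t$ ($n$ summands). $S\times S$ carries the coordinatewise operation. For a commutative semigroup $(T,+)$, $x\in T$ and $A\subseteq T$, write $-x+A=\{y\in T: x+y\in A\}$. A set $A\subseteq T$ is thick if for every finite $H\subseteq T$ there is $x\in T$ with $H+x\subseteq A$. A set $A\subseteq T$ is piecewise syndetic if there is a finite set $F\subseteq T$ such that $\bigcup_{x\in F}(-x+A)$ is thick. -}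

module Defs where

open import Level using (Level; _⊔_) renaming (suc to lsuc)
open import Data.Nat using (ℕ; zero; suc)
open import Data.Product using (Σ; ∃; _×_; _,_)
open import Data.List using (List)
open import Data.List.Relation.Unary.All using (All)
open import Data.List.Relation.Unary.Any using (Any)
open import Relation.Binary.PropositionalEquality using (_≡_)
open import Algebra.Structures using (IsCommutativeSemigroup)

record CommSemigroup (c : Level) : Set (lsuc c) where
  field
    Carrier : Set c
    _∙_     : Carrier → Carrier → Carrier
    isCommutativeSemigroup : IsCommutativeSemigroup _≡_ _∙_

Subset : ∀ {c} → Set c → (ℓ : Level) → Set (c ⊔ lsuc ℓ)
Subset T ℓ = T → Set ℓ

module _ {c} (S : CommSemigroup c) where
  open CommSemigroup S

  -- n t = t + ... + t (n summands), for n ∈ ℕ = {1,2,...}; argument k represents n = k+1.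
  times1+ : ℕ → Carrier → Carrier
  times1+ zero    t = t
  times1+ (suc k) t = times1+ k t ∙ t

  translate : ∀ {ℓ} → Carrier → Subset Carrier ℓ → Subset Carrier ℓ
  translate x A y = A (x ∙ y)

  Thick : ∀ {ℓ} → Subset Carrier ℓ → Set (c ⊔ ℓ)
  Thick A = (H : List Carrier) → ∃ λ x → All (λ h → A (h ∙ x)) H

  PiecewiseSyndetic : ∀ {ℓ} → Subset Carrier ℓ → Set (c ⊔ ℓ)
  PiecewiseSyndetic A =
    ∃ λ (F : List Carrier) → Thick (λ y → Any (λ x → translate x A y) F)

_×ˢ_ : ∀ {c} → CommSemigroup c → CommSemigroup c → CommSemigroup c
S ×ˢ T = record
  { Carrier = S.Carrier × T.Carrier
  ; _∙_ = λ { (a , b) (a' , b') → (a S.∙ a') , (b T.∙ b') }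
  ; isCommutativeSemigroup = record
    { isSemigroup = record
      { isMagma = record
        { isEquivalence = Eq.isEquivalence
        ; ∙-cong = λ { Eq.refl Eq.refl → Eq.refl } }
      ; assoc = λ { (a , b) (a' , b') (a'' , b'') →
          Eq.cong₂ _,_ (SC.assoc a a' a'') (TC.assoc b b' b'') } }
    ; comm = λ { (a , b) (a' , b') → Eq.cong₂ _,_ (SC.comm a a') (TC.comm b b') } } }
  where
  import Relation.Binary.PropositionalEquality as Eq
  module S = CommSemigroup S
  module T = CommSemigroup T
  module SC = IsCommutativeSemigroup S.isCommutativeSemigroup
  module TC = IsCommutativeSemigroup T.isCommutativeSemigroup

-- Write φ(s,t) = (s + at + c, t) as ψ(s,t) = (s + at, t) followed by adding c to the first
-- coordinate. Then ψ is an endomorphism of S × S and φ(u + v) = φ(u) + ψ(v), so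
-- φ(f + h + x) = φ(f) + ψ(h) + ψ(x): with F replaced by φ(F), φ(M) is piecewise syndetic
-- provided every finite H has a common translate H + y inside the image of ψ. That image is
-- thick: (p, q) + (aW, r) = ψ(p + aw, q + r) whenever w + (q + r) = W, so it suffices to take
-- for W a common multiple of the finitely many q + r.
module Submission where

open import Defs
open import Data.Nat using (ℕ; zero; suc)
open import Data.Product using (∃; ∃₂; _×_; _,_; proj₁; proj₂)
open import Data.List using (List; []; _∷_; map)
open import Data.List.Relation.Unary.All as All using (All; []; _∷_)
open import Data.List.Relation.Unary.All.Properties using (map⁻)
open import Data.List.Relation.Unary.Any as Any using (Any)
open import Data.List.Relation.Unary.Any.Properties using (map⁺)
open import Function using (_∘_)
open import Relation.Binary.PropositionalEquality
  using (_≡_; refl; sym; cong; subst; module ≡-Reasoning)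
open import Algebra.Bundles using (CommutativeSemigroup)
open import Algebra.Morphism.Definitions using (Homomorphic₂)
import Algebra.Definitions.RawMagma as RawMagmaDefinitions
import Algebra.Properties.CommutativeSemigroup as CommutativeSemigroupProperties
import Algebra.Properties.CommutativeSemigroup.Divisibility as CommutativeSemigroupDivisibility

open ≡-Reasoning

commutativeSemigroup : ∀ {c} → CommSemigroup c → CommutativeSemigroup c c
commutativeSemigroup S =
  record { isCommutativeSemigroup = CommSemigroup.isCommutativeSemigroup S }

module _ {c c′} (G : CommSemigroup c) (G′ : CommSemigroup c′) where
  private
    module G  = CommutativeSemigroup (commutativeSemigroup G)
    module G′ = CommutativeSemigroup (commutativeSemigroup G′)

  image-piecewiseSyndetic :
    (ψ : G.Carrier → G′.Carrier) → Homomorphic₂ G.Carrier G′.Carrier _≡_ ψ G._∙_ G′._∙_ →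
    Thick G′ (λ z → ∃ λ u → ψ u ≡ z) →
    (φ : G.Carrier → G′.Carrier) → (∀ u v → φ (u G.∙ v) ≡ φ u G′.∙ ψ v) →
    ∀ {ℓ ℓ′} {A : Subset G.Carrier ℓ} {B : Subset G′.Carrier ℓ′} →
    (∀ {u} → A u → B (φ u)) →
    PiecewiseSyndetic G A → PiecewiseSyndetic G′ B
  image-piecewiseSyndetic ψ ψ-homo ψ-thick φ φ-∙ {A = A} {B} A⇒B (F , thick) =
    map φ F , λ H′ →
      let y , lifts = ψ-thick H′
          x , hits  = thick (All.reduce proj₁ lifts)
      in y G′.∙ ψ x , transfer lifts hits
    where
    shift : ∀ {h′ y h x} → ψ h ≡ h′ G′.∙ y → ∀ f →
            φ (f G.∙ (h G.∙ x)) ≡ φ f G′.∙ (h′ G′.∙ (y G′.∙ ψ x))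
    shift {h′} {y} {h} {x} lift f = begin
      φ (f G.∙ (h G.∙ x))               ≡⟨ φ-∙ f (h G.∙ x) ⟩
      φ f G′.∙ ψ (h G.∙ x)              ≡⟨ cong (φ f G′.∙_) (ψ-homo h x) ⟩
      φ f G′.∙ (ψ h G′.∙ ψ x)           ≡⟨ cong (λ z → φ f G′.∙ (z G′.∙ ψ x)) lift ⟩
      φ f G′.∙ ((h′ G′.∙ y) G′.∙ ψ x)   ≡⟨ cong (φ f G′.∙_) (G′.assoc h′ y (ψ x)) ⟩
      φ f G′.∙ (h′ G′.∙ (y G′.∙ ψ x))   ∎

    transfer : ∀ {H′ y x} (lifts : All (λ h′ → ∃ λ h → ψ h ≡ h′ G′.∙ y) H′) →
      All (λ h → Any (λ f → A (f G.∙ (h G.∙ x))) F) (All.reduce proj₁ lifts) →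
      All (λ h′ → Any (λ f′ → B (f′ G′.∙ (h′ G′.∙ (y G′.∙ ψ x)))) (map φ F)) H′
    transfer []                   []           = []
    transfer ((h , lift) ∷ lifts) (hit ∷ hits) =
      map⁺ (Any.map (λ {f} a → subst B (shift lift f) (A⇒B a)) hit) ∷ transfer lifts hits

module _ {c} (S : CommSemigroup c) where
  open CommSemigroup S using (Carrier; _∙_)
  open CommutativeSemigroup (commutativeSemigroup S) using (assoc; rawMagma)
  open RawMagmaDefinitions rawMagma using (_∣_; _,_)
  open CommutativeSemigroupProperties (commutativeSemigroup S) using (interchange; xy∙z≈xz∙y)
  open CommutativeSemigroupDivisibility (commutativeSemigroup S) using (x∣xy; x∣ʳy⇒x∣ʳzy)

  private
    _∙²_ : Carrier × Carrier → Carrier × Carrier → Carrier × Carrier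
    _∙²_ = CommSemigroup._∙_ (S ×ˢ S)

  times1+-homo : ∀ k x y → times1+ S k (x ∙ y) ≡ times1+ S k x ∙ times1+ S k y
  times1+-homo zero    x y = refl
  times1+-homo (suc k) x y = begin
    times1+ S k (x ∙ y) ∙ (x ∙ y)                      ≡⟨ cong (_∙ (x ∙ y)) (times1+-homo k x y) ⟩
    (times1+ S k x ∙ times1+ S k y) ∙ (x ∙ y)          ≡⟨ interchange _ _ x y ⟩
    (times1+ S k x ∙ x) ∙ (times1+ S k y ∙ y)          ∎

  commonMultiple : Carrier → (xs : List Carrier) → ∃ λ m → All (_∣ m) xs
  commonMultiple r []       = r , []
  commonMultiple r (x ∷ xs) =
    let m , xs∣m = commonMultiple r xs
    in x ∙ m , x∣xy x m ∷ All.map (x∣ʳy⇒x∣ʳzy x) xs∣m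

  shear : ℕ → Carrier × Carrier → Carrier × Carrier
  shear k (s , t) = s ∙ times1+ S k t , t

  shift₁ : Carrier → Carrier × Carrier → Carrier × Carrier
  shift₁ r (s , t) = s ∙ r , t

  shear-homo : ∀ k → Homomorphic₂ (Carrier × Carrier) (Carrier × Carrier) _≡_ (shear k) _∙²_ _∙²_
  shear-homo k (s , t) (s′ , t′) = cong (_, t ∙ t′) (begin
    (s ∙ s′) ∙ times1+ S k (t ∙ t′)                    ≡⟨ cong ((s ∙ s′) ∙_) (times1+-homo k t t′) ⟩
    (s ∙ s′) ∙ (times1+ S k t ∙ times1+ S k t′)        ≡⟨ interchange s s′ _ _ ⟩
    (s ∙ times1+ S k t) ∙ (s′ ∙ times1+ S k t′)        ∎)

  shift₁-∙ : ∀ r u v → shift₁ r (u ∙² v) ≡ shift₁ r u ∙² v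
  shift₁-∙ r (s , t) (s′ , t′) = cong (_, t ∙ t′) (xy∙z≈xz∙y s s′ r)

  shift₁-shear-∙ : ∀ r k u v →
    shift₁ r (shear k (u ∙² v)) ≡ shift₁ r (shear k u) ∙² shear k v
  shift₁-shear-∙ r k u v = begin
    shift₁ r (shear k (u ∙² v))              ≡⟨ cong (shift₁ r) (shear-homo k u v) ⟩
    shift₁ r (shear k u ∙² shear k v)        ≡⟨ shift₁-∙ r (shear k u) (shear k v) ⟩
    shift₁ r (shear k u) ∙² shear k v        ∎

  -- Without an identity in S, the second coordinate of the translating element is padded with r.
  shear-image-thick : Carrier → ∀ k → Thick (S ×ˢ S) (λ z → ∃ λ u → shear k u ≡ z)
  shear-image-thick r k H =
    let m , divides = commonMultiple r (map (λ h → proj₂ h ∙ r) H)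
    in (times1+ S k m , r) , All.map (lift m) (map⁻ divides)
    where
    lift : ∀ m {h} → proj₂ h ∙ r ∣ m → ∃ λ u → shear k u ≡ h ∙² (times1+ S k m , r)
    lift m {p , q} (w , w∙qr≡m) = (p ∙ times1+ S k w , q ∙ r) , cong (_, q ∙ r) (begin
      (p ∙ times1+ S k w) ∙ times1+ S k (q ∙ r)   ≡⟨ assoc p _ _ ⟩
      p ∙ (times1+ S k w ∙ times1+ S k (q ∙ r))   ≡⟨ cong (p ∙_) (sym (times1+-homo k w (q ∙ r))) ⟩
      p ∙ times1+ S k (w ∙ (q ∙ r))               ≡⟨ cong (λ z → p ∙ times1+ S k z) w∙qr≡m ⟩
      p ∙ times1+ S k m                           ∎)

lemma6 : ∀ {c ℓ} (S : CommSemigroup c) →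
    let open CommSemigroup S in
    (M : Subset (Carrier × Carrier) ℓ) →
    PiecewiseSyndetic (S ×ˢ S) M →
    (cc : Carrier) (k : ℕ) →
    PiecewiseSyndetic (S ×ˢ S)
      (λ z → ∃₂ λ (s t : Carrier) →
        M (s , t) × (z ≡ ((s ∙ times1+ S k t) ∙ cc , t)))
lemma6 S M M-ps cc k =
  image-piecewiseSyndetic (S ×ˢ S) (S ×ˢ S)
    (shear S k) (shear-homo S k) (shear-image-thick S cc k)
    (shift₁ S cc ∘ shear S k) (shift₁-shear-∙ S cc k)
    {B = λ z → ∃₂ λ s t → M (s , t) × (z ≡ shift₁ S cc (shear S k (s , t)))}
    (λ {u} m → proj₁ u , proj₂ u , m , refl)
    M-ps
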